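{- Let $a,b,d,n$ be positive integers with $ab$ odd. Then $$t(a,3a,2b,d;n)=\frac 23\big(N(a,3a,2b,d;8n+4a+2b+d)-N(a,3a,2b,4d;8n+4a+2b+d)\big).$$
   Context: For positive integers $a_1,\dots,a_k$ and a nonnegative integer $n$, $N(a_1,\dots,a_k;n)$ is the number of $(x_1,\dots,x_k)\in\mathbb Z^k$ with $n=a_1x_1^2+\cdots+a_kx_k^2$, and $t(a_1,\dots,a_k;n)$ is the number of $(x_1,\dots,x_k)\in\mathbb Z^k$ with $n=a_1\frac{x_1(x_1-1)}2+\cdots+a_k\frac{x_k(x_k-1)}2$. -}

module Defs where

open import Data.Nat using (ℕ; zero; suc; _+_; _*_)
open import Data.Integer as ℤ using (ℤ; +_; -[1+_])
open import Data.List using (List; []; _∷_; map; concatMap; length; filter)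
open import Data.Vec using (Vec; []; _∷_)
open import Relation.Binary.PropositionalEquality using (_≡_)
open import Data.Integer.Properties using () renaming (_≟_ to _≟ℤ_)

intRange : ℕ → List ℤ
intRange zero = + 0 ∷ []
intRange (suc B) = -[1+ B ] ∷ intRange B Data.List.++ (+ suc B ∷ [])

box : (k : ℕ) → ℕ → List (Vec ℤ k)
box zero B = [] ∷ []
box (suc k) B = concatMap (λ x → map (x ∷_) (box k B)) (intRange B)

wsum : {k : ℕ} → (ℤ → ℤ) → Vec ℕ k → Vec ℤ k → ℤ
wsum f [] [] = + 0
wsum f (a ∷ as) (x ∷ xs) = (+ a) ℤ.* f x ℤ.+ wsum f as xs

square : ℤ → ℤ
square x = x ℤ.* x

-- x(x-1)/2, computed exactly (x(x-1) is always even)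
triangular : ℤ → ℤ
triangular x = (x ℤ.* (x ℤ.- + 1)) ℤ./ (+ 2)

countIn : {k : ℕ} → (ℤ → ℤ) → Vec ℕ k → ℕ → ℕ → ℕ
countIn {k} f as B n = length (filter (λ xs → wsum f as xs ≟ℤ + n) (box k B))

-- N(a₁,…,a_k; n) : number of (x₁,…,x_k) ∈ ℤ^k with n = Σ aᵢ xᵢ².
-- For positive aᵢ every solution has |xᵢ| ≤ n, so the box of radius n+1 contains all of them.
N : {k : ℕ} → Vec ℕ k → ℕ → ℕ
N as n = countIn square as (suc n) n

-- t(a₁,…,a_k; n) : number of (x₁,…,x_k) ∈ ℤ^k with n = Σ aᵢ xᵢ(xᵢ-1)/2.
-- For positive aᵢ every solution has xᵢ ∈ [-n, n+1], inside the box of radius n+1.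
t : {k : ℕ} → Vec ℕ k → ℕ → ℕ
t as n = countIn triangular as (suc n) n

{-# OPTIONS --safe #-}
-- Split the solutions of a y₁² + 3a y₂² + 2b y₃² + d y₄² = 8n + 4a + 2b + d by the parities of
-- y₄ and y₁. Writing y₄ = 2w, the solutions with y₄ even are exactly those of the form with 4d
-- in place of d. When y₄ is odd, reading the equation modulo 2, 4 and 8 forces y₂ ≡ y₁ (mod 2),
-- and y₃ odd when y₁ is odd. As an odd square is 1 + 8·x(x − 1)/2, the substitution y = 2x − 1
-- identifies the all-odd solutions with the representations counted by t. Among these, negating
-- y₂ exchanges the classes y₁ ≢ y₂ and y₁ ≡ y₂ (mod 4), and the automorphism
-- (y₁, y₂) ↦ ((y₁ + 3y₂)/2, (y₁ − y₂)/2) of x² + 3y² maps the class y₁ ≡ y₂ (mod 4) onto the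
-- solutions with y₁ even and y₄ odd. If E counts the latter, then t = 2E and
-- N(a, 3a, 2b, d) = 3E + N(a, 3a, 2b, 4d).

module Submission where

open import Defs

open import Data.Empty using (⊥-elim)
open import Data.Fin using (zero; suc)
open import Data.Fin.Properties using (injective⇒≤)
open import Data.Integer as ℤ using (ℤ; +_; -[1+_]; ∣_∣; _/ℕ_; _%ℕ_)
import Data.Integer.Properties as ℤ
open import Data.Integer.DivMod using (a≡a%ℕn+[a/ℕn]*n; n%ℕd<d)
open import Data.Integer.Tactic.RingSolver using (solve-∀)
import Data.Nat.Tactic.RingSolver as ℕ-Solver
open import Data.List using (List; []; _∷_; length; filter; lookup; map; concatMap; cartesianProductWith; _++_)
open import Data.List.Membership.Propositional using (_∈_)
open import Data.List.Membership.Propositional.Properties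
  using (∈-lookup; ∈-filter⁺; ∈-filter⁻; ∈-++⁺ˡ; ∈-++⁺ʳ; ∈-cartesianProductWith⁺)
import Data.List.Membership.Setoid.Properties as SetoidMembership
open import Data.List.Properties using (filter-≐)
open import Data.List.Relation.Binary.Disjoint.Propositional using (Disjoint)
open import Data.List.Relation.Unary.All as All using (All; []; _∷_)
import Data.List.Relation.Unary.All.Properties as All
open import Data.List.Relation.Unary.AllPairs using ([]; _∷_)
open import Data.List.Relation.Unary.Any using (here; there; index)
open import Data.List.Relation.Unary.Unique.Propositional using (Unique)
open import Data.List.Relation.Unary.Unique.Propositional.Properties using (filter⁺; ++⁺; cartesianProductWith⁺)
open import Data.Nat as ℕ using (ℕ; zero; suc; _≤_; _<_; z≤n; s≤s; NonZero)
import Data.Nat.Properties as ℕ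
open import Data.Nat.DivMod using (m*n/n≡m)
open import Data.Nat.Divisibility using (_∣_; divides; ∣m⇒∣m*n; ∣n⇒∣m*n)
open import Data.Product using (_×_; _,_; proj₁; proj₂)
open import Data.Sum using (inj₁; inj₂)
open import Data.Vec as Vec using (Vec; []; _∷_; head; last; sum)
open import Data.Vec.Properties using (∷-injective)
open import Data.Vec.Relation.Unary.All as VecAll using ([]; _∷_) renaming (All to VecAll)
import Data.Vec.Relation.Unary.All.Properties as VecAll
open import Function using (_∘_; Injective)
open import Level using (0ℓ)
open import Relation.Binary.PropositionalEquality
open import Relation.Nullary using (¬_; yes; no; contradiction)
open import Relation.Nullary.Decidable using (decidable-stable; map′)
open import Relation.Unary using (Pred; Decidable; _∩_; ∁; _≐_; _⊆_)
open import Relation.Unary.Properties using (_∩?_; ∁?)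
open import Algebra.Properties.AbelianGroup ℤ.+-0-abelianGroup using (∙-cancelˡ; ∙-cancelʳ)

module _ {A : Set} where

  Unique⇒lookup-injective : ∀ {xs : List A} → Unique xs → Injective _≡_ _≡_ (lookup xs)
  Unique⇒lookup-injective {_ ∷ _} _         {zero}  {zero}  _ = refl
  Unique⇒lookup-injective {_ ∷ _} (x∉ ∷ _)  {zero}  {suc j} e = ⊥-elim (All.lookup x∉ (∈-lookup j) e)
  Unique⇒lookup-injective {_ ∷ _} (x∉ ∷ _)  {suc i} {zero}  e = ⊥-elim (All.lookup x∉ (∈-lookup i) (sym e))
  Unique⇒lookup-injective {_ ∷ _} (_ ∷ uxs) {suc i} {suc j} e = cong suc (Unique⇒lookup-injective uxs e)

  length-≤-by-injection : ∀ {B : Set} {xs : List A} {ys : List B} (f : A → B) → Unique xs →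
    (∀ {x} → x ∈ xs → f x ∈ ys) → (∀ {x y} → x ∈ xs → y ∈ xs → f x ≡ f y → x ≡ y) →
    length xs ≤ length ys
  length-≤-by-injection {B} f uxs f∈ys f-inj = injective⇒≤ {f = λ i → index (f∈ys (∈-lookup i))} λ {i} {j} e →
    Unique⇒lookup-injective uxs (f-inj (∈-lookup i) (∈-lookup j)
      (SetoidMembership.index-injective (setoid B) (f∈ys (∈-lookup i)) (f∈ys (∈-lookup j)) e))

  module _ {P R : Pred A 0ℓ} (P? : Decidable P) (R? : Decidable R) where

    length-filter-split : ∀ xs →
      length (filter P? xs) ≡ length (filter (P? ∩? R?) xs) ℕ.+ length (filter (P? ∩? ∁? R?) xs)
    length-filter-split [] = refl
    length-filter-split (x ∷ xs) with P? x | R? x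
    ... | yes _ | yes _ = cong suc (length-filter-split xs)
    ... | yes _ | no _  = trans (cong suc (length-filter-split xs)) (sym (ℕ.+-suc _ _))
    ... | no _  | _     = length-filter-split xs

concatMap-map≡cartesianProductWith : ∀ {A B C : Set} (f : A → B → C) xs ys →
  concatMap (λ x → map (f x) ys) xs ≡ cartesianProductWith f xs ys
concatMap-map≡cartesianProductWith f []       ys = refl
concatMap-map≡cartesianProductWith f (x ∷ xs) ys = cong (map (f x) ys ++_) (concatMap-map≡cartesianProductWith f xs ys)

InBox : ∀ {k} → ℕ → Pred (Vec ℤ k) 0ℓ
InBox B = VecAll (λ z → ∣ z ∣ ≤ B)

intRange-bounded : ∀ B → All (λ z → ∣ z ∣ ≤ B) (intRange B)
intRange-bounded zero    = z≤n ∷ []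
intRange-bounded (suc B) = ℕ.≤-refl ∷ All.++⁺ (All.map ℕ.m≤n⇒m≤1+n (intRange-bounded B)) (ℕ.≤-refl ∷ [])

intRange-complete : ∀ {B z} → ∣ z ∣ ≤ B → z ∈ intRange B
intRange-complete {zero}  {+ zero} _ = here refl
intRange-complete {suc B} {z} |z|≤1+B with ℕ.m≤n⇒m<n∨m≡n |z|≤1+B
... | inj₁ |z|<1+B = there (∈-++⁺ˡ (intRange-complete (ℕ.≤-pred |z|<1+B)))
... | inj₂ |z|≡1+B = extreme z |z|≡1+B
  where
  extreme : ∀ z → ∣ z ∣ ≡ suc B → z ∈ intRange (suc B)
  extreme -[1+ _ ]        refl = here refl
  extreme (+ .(suc B)) refl = there (∈-++⁺ʳ (intRange B) (here refl))

intRange-unique : ∀ B → Unique (intRange B)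
intRange-unique zero    = [] ∷ []
intRange-unique (suc B) =
  All.++⁺ (All.map head≢ (intRange-bounded B)) ((λ ()) ∷ []) ∷ ++⁺ (intRange-unique B) ([] ∷ []) last∉
  where
  head≢ : ∀ {z} → ∣ z ∣ ≤ B → -[1+ B ] ≢ z
  head≢ |z|≤B refl = ℕ.n≮n B |z|≤B
  last∉ : Disjoint (intRange B) (+ suc B ∷ [])
  last∉ (z∈ , here refl) = ℕ.n≮n B (All.lookup (intRange-bounded B) z∈)

box-suc : ∀ k B → box (suc k) B ≡ cartesianProductWith _∷_ (intRange B) (box k B)
box-suc k B = concatMap-map≡cartesianProductWith _∷_ (intRange B) (box k B)

box-unique : ∀ k B → Unique (box k B)
box-unique zero    B = [] ∷ []
box-unique (suc k) B = subst Unique (sym (box-suc k B))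
  (cartesianProductWith⁺ _∷_ ∷-injective (intRange-unique B) (box-unique k B))

box-complete : ∀ {k B} {v : Vec ℤ k} → InBox B v → v ∈ box k B
box-complete []                = here refl
box-complete {suc k} {B} (h ∷ hs) = subst (_ ∈_) (sym (box-suc k B))
  (∈-cartesianProductWith⁺ _∷_ (intRange-complete h) (box-complete hs))

count : ∀ {k} {P : Pred (Vec ℤ k) 0ℓ} → Decidable P → ℕ → ℕ
count {k} P? B = length (filter P? (box k B))

count-split : ∀ {k} {P R : Pred (Vec ℤ k) 0ℓ} (P? : Decidable P) (R? : Decidable R) B →
  count P? B ≡ count (P? ∩? R?) B ℕ.+ count (P? ∩? ∁? R?) B
count-split {k} P? R? B = length-filter-split P? R? (box k B)

count-≐ : ∀ {k} {P Q : Pred (Vec ℤ k) 0ℓ} (P? : Decidable P) (Q? : Decidable Q) B → P ≐ Q → count P? B ≡ count Q? B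
count-≐ {k} P? Q? B P≐Q = cong length (filter-≐ P? Q? P≐Q (box k B))

record SubsetBijection {A : Set} (P Q : Pred A 0ℓ) : Set where
  field
    to from   : A → A
    to-into   : ∀ v → P v → Q (to v)
    from-into : ∀ v → Q v → P (from v)
    from∘to   : ∀ v → P v → from (to v) ≡ v
    to∘from   : ∀ v → Q v → to (from v) ≡ v

open SubsetBijection

count-≤-by-injection : ∀ {k} {P Q : Pred (Vec ℤ k) 0ℓ} (P? : Decidable P) (Q? : Decidable Q) {B C} →
  Q ⊆ InBox C → (f g : Vec ℤ k → Vec ℤ k) → (∀ v → P v → Q (f v)) → (∀ v → P v → g (f v) ≡ v) →
  count P? B ≤ count Q? C
count-≤-by-injection {k} {P} P? Q? {B} {C} Q-bounded f g f-into g∘f =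
  length-≤-by-injection f (filter⁺ P? (box-unique k B)) f∈ f-inj
  where
  P-of : ∀ {v} → v ∈ filter P? (box k B) → P v
  P-of v∈ = proj₂ (∈-filter⁻ P? {xs = box k B} v∈)
  f∈ : ∀ {v} → v ∈ filter P? (box k B) → f v ∈ filter Q? (box k C)
  f∈ v∈ = let Qfv = f-into _ (P-of v∈) in ∈-filter⁺ Q? (box-complete (Q-bounded Qfv)) Qfv
  f-inj : ∀ {u v} → u ∈ filter P? (box k B) → v ∈ filter P? (box k B) → f u ≡ f v → u ≡ v
  f-inj u∈ v∈ e = trans (sym (g∘f _ (P-of u∈))) (trans (cong g e) (g∘f _ (P-of v∈)))

count-≡-by-bijection : ∀ {k} {P Q : Pred (Vec ℤ k) 0ℓ} (P? : Decidable P) (Q? : Decidable Q) {B C} →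
  P ⊆ InBox B → Q ⊆ InBox C → SubsetBijection P Q → count P? B ≡ count Q? C
count-≡-by-bijection P? Q? P-bounded Q-bounded φ = ℕ.≤-antisym
  (count-≤-by-injection P? Q? Q-bounded (φ .to) (φ .from) (φ .to-into) (φ .from∘to))
  (count-≤-by-injection Q? P? P-bounded (φ .from) (φ .to) (φ .from-into) (φ .to∘from))

module _ (f : ℤ → ℤ) (g : ℤ → ℕ) (f≡g : ∀ x → f x ≡ + g x) (g-bound : ∀ x → ∣ x ∣ ≤ suc (g x)) where

  private
    wsumℕ : ∀ {k} → Vec ℕ k → Vec ℤ k → ℕ
    wsumℕ []       []       = 0
    wsumℕ (a ∷ as) (x ∷ xs) = a ℕ.* g x ℕ.+ wsumℕ as xs

    wsum≡wsumℕ : ∀ {k} (as : Vec ℕ k) xs → wsum f as xs ≡ + wsumℕ as xs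
    wsum≡wsumℕ []       []       = refl
    wsum≡wsumℕ (a ∷ as) (x ∷ xs) = begin
      + a ℤ.* f x ℤ.+ wsum f as xs     ≡⟨ cong₂ (λ p q → + a ℤ.* p ℤ.+ q) (f≡g x) (wsum≡wsumℕ as xs) ⟩
      + a ℤ.* + g x ℤ.+ + wsumℕ as xs  ≡⟨ cong (ℤ._+ _) (ℤ.pos-* a (g x)) ⟨
      + (a ℕ.* g x) ℤ.+ + wsumℕ as xs  ≡⟨ ℤ.pos-+ (a ℕ.* g x) (wsumℕ as xs) ⟨
      + (a ℕ.* g x ℕ.+ wsumℕ as xs)    ∎
      where open ≡-Reasoning

    wsumℕ-bounded : ∀ {k} {as : Vec ℕ k} → VecAll NonZero as → ∀ {n} xs → wsumℕ as xs ≤ n → InBox (suc n) xs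
    wsumℕ-bounded []                        []       _ = []
    wsumℕ-bounded {as = a ∷ _} (a≢0 ∷ as≢0) (x ∷ xs) h =
      ℕ.≤-trans (g-bound x) (s≤s (ℕ.≤-trans (ℕ.m≤n*m (g x) a {{a≢0}}) (ℕ.m+n≤o⇒m≤o _ h)))
      ∷ wsumℕ-bounded as≢0 xs (ℕ.m+n≤o⇒n≤o _ h)

  wsum≡⇒InBox : ∀ {k} {as : Vec ℕ k} → VecAll NonZero as → ∀ {n} xs → wsum f as xs ≡ + n → InBox (suc n) xs
  wsum≡⇒InBox {as = as} as≢0 xs e =
    wsumℕ-bounded as≢0 xs (ℕ.≤-reflexive (ℤ.+-injective (trans (sym (wsum≡wsumℕ as xs)) e)))

SquareSol TriangularSol : ∀ {k} → Vec ℕ k → ℕ → Pred (Vec ℤ k) 0ℓ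
SquareSol     as n xs = wsum square as xs ≡ + n
TriangularSol as n xs = wsum triangular as xs ≡ + n

SquareSol? : ∀ {k} (as : Vec ℕ k) n → Decidable (SquareSol as n)
SquareSol? as n xs = wsum square as xs ℤ.≟ + n

TriangularSol? : ∀ {k} (as : Vec ℕ k) n → Decidable (TriangularSol as n)
TriangularSol? as n xs = wsum triangular as xs ℤ.≟ + n

square≡∣∣*∣∣ : ∀ x → square x ≡ + (∣ x ∣ ℕ.* ∣ x ∣)
square≡∣∣*∣∣ (+ n)    = sym (ℤ.pos-* n n)
square≡∣∣*∣∣ -[1+ n ] = refl

∣∣≤1+∣∣*∣∣ : ∀ x → ∣ x ∣ ≤ suc (∣ x ∣ ℕ.* ∣ x ∣)
∣∣≤1+∣∣*∣∣ x with ∣ x ∣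
... | zero  = z≤n
... | suc j = ℕ.m≤n⇒m≤1+n (ℕ.m≤m*n (suc j) (suc j))

SquareSol-bounded : ∀ {k} {as : Vec ℕ k} → VecAll NonZero as → ∀ {n} → SquareSol as n ⊆ InBox (suc n)
SquareSol-bounded as≢0 {_} {xs} = wsum≡⇒InBox square _ square≡∣∣*∣∣ ∣∣≤1+∣∣*∣∣ as≢0 xs

module Triangular where
  open import Data.Integer using (_+_; _-_; _*_)

  tri : ℕ → ℕ
  tri zero    = 0
  tri (suc j) = suc j ℕ.+ tri j

  tri*2 : ∀ j → tri j ℕ.* 2 ≡ j ℕ.* suc j
  tri*2 zero    = refl
  tri*2 (suc j) = begin
    (suc j ℕ.+ tri j) ℕ.* 2         ≡⟨ ℕ.*-distribʳ-+ 2 (suc j) (tri j) ⟩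
    suc j ℕ.* 2 ℕ.+ tri j ℕ.* 2     ≡⟨ cong (suc j ℕ.* 2 ℕ.+_) (tri*2 j) ⟩
    suc j ℕ.* 2 ℕ.+ j ℕ.* suc j     ≡⟨ cong (ℕ._+ j ℕ.* suc j) (ℕ.*-comm (suc j) 2) ⟩
    2 ℕ.* suc j ℕ.+ j ℕ.* suc j     ≡⟨ ℕ.*-distribʳ-+ (suc j) 2 j ⟨
    suc (suc j) ℕ.* suc j           ≡⟨ ℕ.*-comm (suc (suc j)) (suc j) ⟩
    suc j ℕ.* suc (suc j)           ∎
    where open ≡-Reasoning

  j≤tri : ∀ j → j ≤ tri j
  j≤tri zero    = z≤n
  j≤tri (suc j) = ℕ.m≤m+n (suc j) (tri j)

  triangularℕ : ℤ → ℕ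
  triangularℕ (+ zero)  = 0
  triangularℕ (+ suc j) = tri j
  triangularℕ -[1+ j ]  = tri (suc j)

  x*[x-1]≡triangularℕ*2 : ∀ x → x * (x - + 1) ≡ + (triangularℕ x ℕ.* 2)
  x*[x-1]≡triangularℕ*2 (+ zero)  = refl
  x*[x-1]≡triangularℕ*2 (+ suc j) =
    trans (sym (ℤ.pos-* (suc j) j)) (cong +_ (trans (ℕ.*-comm (suc j) j) (sym (tri*2 j))))
  x*[x-1]≡triangularℕ*2 -[1+ j ]  =
    trans (cong (λ y → -[1+ j ] * -[1+ y ]) (ℕ.+-identityʳ (suc j))) (cong +_ (sym (tri*2 (suc j))))

  -- The first step holds because x / + 2 unfolds to + 1 * (x /ℕ 2).
  triangular≡triangularℕ : ∀ x → triangular x ≡ + triangularℕ x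
  triangular≡triangularℕ x = begin
    triangular x                           ≡⟨ ℤ.*-identityˡ _ ⟩
    (x * (x - + 1)) /ℕ 2                   ≡⟨ cong (_/ℕ 2) (x*[x-1]≡triangularℕ*2 x) ⟩
    + (triangularℕ x ℕ.* 2 ℕ./ 2)          ≡⟨ cong +_ (m*n/n≡m (triangularℕ x) 2) ⟩
    + triangularℕ x                        ∎
    where open ≡-Reasoning

  2*triangular : ∀ x → + 2 * triangular x ≡ x * (x - + 1)
  2*triangular x = begin
    + 2 * triangular x          ≡⟨ cong (+ 2 *_) (triangular≡triangularℕ x) ⟩
    + 2 * + triangularℕ x       ≡⟨ ℤ.*-comm (+ 2) (+ triangularℕ x) ⟩
    + triangularℕ x * + 2       ≡⟨ ℤ.pos-* (triangularℕ x) 2 ⟨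
    + (triangularℕ x ℕ.* 2)     ≡⟨ x*[x-1]≡triangularℕ*2 x ⟨
    x * (x - + 1)               ∎
    where open ≡-Reasoning

  ∣∣≤1+triangularℕ : ∀ x → ∣ x ∣ ≤ suc (triangularℕ x)
  ∣∣≤1+triangularℕ (+ zero)  = z≤n
  ∣∣≤1+triangularℕ (+ suc j) = s≤s (j≤tri j)
  ∣∣≤1+triangularℕ -[1+ j ]  = ℕ.m≤n⇒m≤1+n (j≤tri (suc j))

open Triangular using (2*triangular)

TriangularSol-bounded : ∀ {k} {as : Vec ℕ k} → VecAll NonZero as → ∀ {n} → TriangularSol as n ⊆ InBox (suc n)
TriangularSol-bounded as≢0 {_} {xs} =
  wsum≡⇒InBox triangular _ Triangular.triangular≡triangularℕ Triangular.∣∣≤1+triangularℕ as≢0 xs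

module Parity where
  open import Data.Integer using (_+_; _-_; _*_; -_)

  half : ℤ → ℤ
  half z = z /ℕ 2

  -- A record, so that z can be inferred from a proof of Odd z.
  record Odd (z : ℤ) : Set where
    constructor odd
    field %ℕ2≡1 : z %ℕ 2 ≡ 1

  odd? : Decidable Odd
  odd? z = map′ odd Odd.%ℕ2≡1 (z %ℕ 2 ℕ.≟ 1)

  ≡%ℕ2+2*half : ∀ z → z ≡ + (z %ℕ 2) + + 2 * half z
  ≡%ℕ2+2*half z = trans (a≡a%ℕn+[a/ℕn]*n z 2) (cong (λ w → + (z %ℕ 2) + w) (ℤ.*-comm (half z) (+ 2)))

  1+2*≢2* : ∀ h k → + 1 + + 2 * h ≢ + 2 * k
  1+2*≢2* h k e = contradiction (ℕ.m*n≡1⇒m≡1 2 ∣ k - h ∣ ∣2[k-h]∣≡1) λ ()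
    where
    2[k-h]≡1 : + 2 * (k - h) ≡ + 1
    2[k-h]≡1 = begin
      + 2 * (k - h)              ≡⟨ distrib k h ⟩
      + 2 * k - + 2 * h          ≡⟨ cong (_- + 2 * h) e ⟨
      + 1 + + 2 * h - + 2 * h    ≡⟨ cancel h ⟩
      + 1                        ∎
      where
      open ≡-Reasoning
      distrib : ∀ k h → + 2 * (k - h) ≡ + 2 * k - + 2 * h
      distrib = solve-∀
      cancel : ∀ h → + 1 + + 2 * h - + 2 * h ≡ + 1
      cancel = solve-∀
    ∣2[k-h]∣≡1 : 2 ℕ.* ∣ k - h ∣ ≡ 1
    ∣2[k-h]∣≡1 = trans (sym (ℤ.abs-* (+ 2) (k - h))) (cong ∣_∣ 2[k-h]≡1)

  parity-unique : ∀ {r s h k} → r < 2 → s < 2 → + r + + 2 * h ≡ + s + + 2 * k → r ≡ s × h ≡ k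
  parity-unique {0} {0} _ _ e = refl , ℤ.*-cancelˡ-≡ (+ 2) _ _ (∙-cancelˡ (+ 0) _ _ e)
  parity-unique {1} {1} _ _ e = refl , ℤ.*-cancelˡ-≡ (+ 2) _ _ (∙-cancelˡ (+ 1) _ _ e)
  parity-unique {0} {1} {h} {k} _ _ e = ⊥-elim (1+2*≢2* k h (trans (sym e) (ℤ.+-identityˡ _)))
  parity-unique {1} {0} {h} {k} _ _ e = ⊥-elim (1+2*≢2* h k (trans e (ℤ.+-identityˡ _)))
  parity-unique {suc (suc _)} (s≤s (s≤s ())) _ _
  parity-unique {_} {suc (suc _)} _ (s≤s (s≤s ())) _

  private
    ≡1+2*⇒%ℕ2×half : ∀ {z} k → z ≡ + 1 + + 2 * k → z %ℕ 2 ≡ 1 × half z ≡ k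
    ≡1+2*⇒%ℕ2×half {z} _ e = parity-unique (n%ℕd<d z 2) (s≤s (s≤s z≤n)) (trans (sym (≡%ℕ2+2*half z)) e)

    ≡2*⇒%ℕ2×half : ∀ {z} k → z ≡ + 2 * k → z %ℕ 2 ≡ 0 × half z ≡ k
    ≡2*⇒%ℕ2×half {z} _ e =
      parity-unique (n%ℕd<d z 2) (s≤s z≤n) (trans (sym (≡%ℕ2+2*half z)) (trans e (sym (ℤ.+-identityˡ _))))

  ≡1+2*⇒odd : ∀ {z} k → z ≡ + 1 + + 2 * k → Odd z
  ≡1+2*⇒odd k e = odd (proj₁ (≡1+2*⇒%ℕ2×half k e))

  ≡1+2*⇒half≡ : ∀ {z} k → z ≡ + 1 + + 2 * k → half z ≡ k
  ≡1+2*⇒half≡ k e = proj₂ (≡1+2*⇒%ℕ2×half k e)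

  ≡2*⇒¬odd : ∀ {z} k → z ≡ + 2 * k → ¬ Odd z
  ≡2*⇒¬odd k e (odd z%2≡1) = contradiction (trans (sym (proj₁ (≡2*⇒%ℕ2×half k e))) z%2≡1) λ ()

  ≡2*⇒half≡ : ∀ {z} k → z ≡ + 2 * k → half z ≡ k
  ≡2*⇒half≡ k e = proj₂ (≡2*⇒%ℕ2×half k e)

  odd⇒≡1+2*half : ∀ {z} → Odd z → z ≡ + 1 + + 2 * half z
  odd⇒≡1+2*half {z} (odd z%2≡1) = trans (≡%ℕ2+2*half z) (cong (λ r → + r + + 2 * half z) z%2≡1)

  ¬odd⇒%ℕ2≡0 : ∀ {z} → ¬ Odd z → z %ℕ 2 ≡ 0
  ¬odd⇒%ℕ2≡0 {z} ¬odd with z %ℕ 2 in z%2≡ | n%ℕd<d z 2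
  ... | 0           | _             = refl
  ... | 1           | _             = contradiction (odd z%2≡) ¬odd
  ... | suc (suc _) | s≤s (s≤s ())

  ¬odd⇒≡2*half : ∀ {z} → ¬ Odd z → z ≡ + 2 * half z
  ¬odd⇒≡2*half {z} ¬odd =
    trans (≡%ℕ2+2*half z) (trans (cong (λ r → + r + + 2 * half z) (¬odd⇒%ℕ2≡0 ¬odd)) (ℤ.+-identityˡ _))

  private
    same-parity⇒≡+2* : ∀ y z → y %ℕ 2 ≡ z %ℕ 2 → y ≡ z + + 2 * (half y - half z)
    same-parity⇒≡+2* y z e = begin
      y                                                   ≡⟨ ≡%ℕ2+2*half y ⟩
      + (y %ℕ 2) + + 2 * half y                           ≡⟨ cong (λ r → + r + + 2 * half y) e ⟩
      + (z %ℕ 2) + + 2 * half y                           ≡⟨ regroup (+ (z %ℕ 2)) (half y) (half z) ⟩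
      + (z %ℕ 2) + + 2 * half z + + 2 * (half y - half z) ≡⟨ cong (_+ + 2 * (half y - half z)) (≡%ℕ2+2*half z) ⟨
      z + + 2 * (half y - half z)                         ∎
      where
      open ≡-Reasoning
      regroup : ∀ r p q → r + + 2 * p ≡ r + + 2 * q + + 2 * (p - q)
      regroup = solve-∀

  odd-odd⇒≡+2* : ∀ {y z} → Odd y → Odd z → y ≡ z + + 2 * (half y - half z)
  odd-odd⇒≡+2* {y} {z} (odd y%2≡1) (odd z%2≡1) = same-parity⇒≡+2* y z (trans y%2≡1 (sym z%2≡1))

  even-even⇒≡+2* : ∀ {y z} → ¬ Odd y → ¬ Odd z → y ≡ z + + 2 * (half y - half z)
  even-even⇒≡+2* {y} {z} ¬odd-y ¬odd-z = same-parity⇒≡+2* y z (trans (¬odd⇒%ℕ2≡0 ¬odd-y) (sym (¬odd⇒%ℕ2≡0 ¬odd-z)))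

  odd-+2* : ∀ {x} y → Odd x → Odd (x + + 2 * y)
  odd-+2* {x} y odd-x = ≡1+2*⇒odd (half x + y) (trans (cong (_+ + 2 * y) (odd⇒≡1+2*half odd-x)) (regroup (half x) y))
    where
    regroup : ∀ p q → + 1 + + 2 * p + + 2 * q ≡ + 1 + + 2 * (p + q)
    regroup = solve-∀

  ¬odd-+2* : ∀ {x} y → ¬ Odd x → ¬ Odd (x + + 2 * y)
  ¬odd-+2* {x} y ¬odd = ≡2*⇒¬odd (half x + y) (trans (cong (_+ + 2 * y) (¬odd⇒≡2*half ¬odd)) (regroup (half x) y))
    where
    regroup : ∀ p q → + 2 * p + + 2 * q ≡ + 2 * (p + q)
    regroup = solve-∀

  odd-+-odd : ∀ {x y} → Odd x → Odd y → ¬ Odd (x + y)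
  odd-+-odd {x} {y} odd-x odd-y =
    ≡2*⇒¬odd (+ 1 + half x + half y) (trans (cong₂ _+_ (odd⇒≡1+2*half odd-x) (odd⇒≡1+2*half odd-y)) (regroup (half x) (half y)))
    where
    regroup : ∀ p q → + 1 + + 2 * p + (+ 1 + + 2 * q) ≡ + 2 * (+ 1 + p + q)
    regroup = solve-∀

  ¬odd-+-odd : ∀ {x y} → ¬ Odd x → Odd y → Odd (x + y)
  ¬odd-+-odd {x} {y} ¬odd-x odd-y =
    ≡1+2*⇒odd (half x + half y) (trans (cong₂ _+_ (¬odd⇒≡2*half ¬odd-x) (odd⇒≡1+2*half odd-y)) (regroup (half x) (half y)))
    where
    regroup : ∀ p q → + 2 * p + (+ 1 + + 2 * q) ≡ + 1 + + 2 * (p + q)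
    regroup = solve-∀

  ¬2∣⇒odd : ∀ {n} → ¬ 2 ∣ n → Odd (+ n)
  ¬2∣⇒odd {n} ¬2∣n = decidable-stable (odd? (+ n)) λ ¬odd →
    ¬2∣n (divides (n ℕ./ 2) (trans (ℤ.+-injective (trans (¬odd⇒≡2*half ¬odd) (sym (ℤ.pos-* 2 (n ℕ./ 2))))) (ℕ.*-comm 2 (n ℕ./ 2))))

open Parity

module Squares where
  open import Data.Integer using (_+_; _-_; _*_)

  toOdd fromOdd : ℤ → ℤ
  toOdd x   = + 2 * x - + 1
  fromOdd y = half y + + 1

  private
    toOdd≡1+2* : ∀ x → + 2 * x - + 1 ≡ + 1 + + 2 * (x - + 1)
    toOdd≡1+2* = solve-∀

  toOdd-odd : ∀ x → Odd (toOdd x)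
  toOdd-odd x = ≡1+2*⇒odd (x - + 1) (toOdd≡1+2* x)

  fromOdd∘toOdd : ∀ x → fromOdd (toOdd x) ≡ x
  fromOdd∘toOdd x = trans (cong (_+ + 1) (≡1+2*⇒half≡ (x - + 1) (toOdd≡1+2* x))) (cancel x)
    where
    cancel : ∀ x → x - + 1 + + 1 ≡ x
    cancel = solve-∀

  toOdd∘fromOdd : ∀ {y} → Odd y → toOdd (fromOdd y) ≡ y
  toOdd∘fromOdd {y} odd-y = trans (regroup (half y)) (sym (odd⇒≡1+2*half odd-y))
    where
    regroup : ∀ h → + 2 * (h + + 1) - + 1 ≡ + 1 + + 2 * h
    regroup = solve-∀

  toOdd-square : ∀ x → toOdd x * toOdd x ≡ + 1 + + 8 * triangular x
  toOdd-square x = begin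
    toOdd x * toOdd x                  ≡⟨ expand x ⟩
    + 1 + + 4 * (x * (x - + 1))        ≡⟨ cong (λ p → + 1 + + 4 * p) (2*triangular x) ⟨
    + 1 + + 4 * (+ 2 * triangular x)   ≡⟨ regroup (triangular x) ⟩
    + 1 + + 8 * triangular x           ∎
    where
    open ≡-Reasoning
    expand : ∀ x → (+ 2 * x - + 1) * (+ 2 * x - + 1) ≡ + 1 + + 4 * (x * (x - + 1))
    expand = solve-∀
    regroup : ∀ T → + 1 + + 4 * (+ 2 * T) ≡ + 1 + + 8 * T
    regroup = solve-∀

  odd-square : ∀ {y} → Odd y → y * y ≡ + 1 + + 8 * triangular (fromOdd y)
  odd-square {y} odd-y = trans (cong (λ z → z * z) (sym (toOdd∘fromOdd odd-y))) (toOdd-square (fromOdd y))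

  even-square : ∀ {y} → ¬ Odd y → y * y ≡ + 4 * (half y * half y)
  even-square {y} ¬odd-y = trans (cong (λ z → z * z) (¬odd⇒≡2*half ¬odd-y)) (regroup (half y))
    where
    regroup : ∀ u → + 2 * u * (+ 2 * u) ≡ + 4 * (u * u)
    regroup = solve-∀

  wsum-square-toOdd : ∀ {k} (as : Vec ℕ k) xs →
    wsum square as (Vec.map toOdd xs) ≡ + sum as + + 8 * wsum triangular as xs
  wsum-square-toOdd []       []       = refl
  wsum-square-toOdd (a ∷ as) (x ∷ xs) = begin
    + a * (toOdd x * toOdd x) + wsum square as (Vec.map toOdd xs)
      ≡⟨ cong₂ (λ p q → + a * p + q) (toOdd-square x) (wsum-square-toOdd as xs) ⟩
    + a * (+ 1 + + 8 * triangular x) + (+ sum as + + 8 * wsum triangular as xs)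
      ≡⟨ regroup (+ a) (+ sum as) (triangular x) (wsum triangular as xs) ⟩
    + a + + sum as + + 8 * (+ a * triangular x + wsum triangular as xs)
      ≡⟨ cong (λ p → p + + 8 * (+ a * triangular x + wsum triangular as xs)) (ℤ.pos-+ a (sum as)) ⟨
    + (a ℕ.+ sum as) + + 8 * wsum triangular (a ∷ as) (x ∷ xs)
      ∎
    where
    open ≡-Reasoning
    regroup : ∀ a s T W → a * (+ 1 + + 8 * T) + (s + + 8 * W) ≡ a + s + + 8 * (a * T + W)
    regroup = solve-∀

  map-fromOdd∘toOdd : ∀ {k} (xs : Vec ℤ k) → Vec.map fromOdd (Vec.map toOdd xs) ≡ xs
  map-fromOdd∘toOdd []       = refl
  map-fromOdd∘toOdd (x ∷ xs) = cong₂ _∷_ (fromOdd∘toOdd x) (map-fromOdd∘toOdd xs)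

  map-toOdd∘fromOdd : ∀ {k} {ys : Vec ℤ k} → VecAll Odd ys → Vec.map toOdd (Vec.map fromOdd ys) ≡ ys
  map-toOdd∘fromOdd []               = refl
  map-toOdd∘fromOdd (odd-y ∷ odd-ys) = cong₂ _∷_ (toOdd∘fromOdd odd-y) (map-toOdd∘fromOdd odd-ys)

  private
    pos-8*+ : ∀ n s {m} → m ≡ 8 ℕ.* n ℕ.+ s → + m ≡ + s + + 8 * + n
    pos-8*+ n s refl = trans (ℤ.pos-+ (8 ℕ.* n) s) (trans (cong (_+ + s) (ℤ.pos-* 8 n)) (ℤ.+-comm (+ 8 * + n) (+ s)))

  triangular⤖odd-squares : ∀ {k} {as : Vec ℕ k} {n m} → m ≡ 8 ℕ.* n ℕ.+ sum as →
    SubsetBijection (TriangularSol as n) (SquareSol as m ∩ VecAll Odd)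
  triangular⤖odd-squares _ .to   = Vec.map toOdd
  triangular⤖odd-squares _ .from = Vec.map fromOdd
  triangular⤖odd-squares {as = as} {n} {m} m≡ .to-into xs sol =
    (begin
      wsum square as (Vec.map toOdd xs)    ≡⟨ wsum-square-toOdd as xs ⟩
      + sum as + + 8 * wsum triangular as xs ≡⟨ cong (λ w → + sum as + + 8 * w) sol ⟩
      + sum as + + 8 * + n                 ≡⟨ pos-8*+ n (sum as) m≡ ⟨
      + m                                  ∎)
    , VecAll.map⁺ (VecAll.universal toOdd-odd xs)
    where open ≡-Reasoning
  triangular⤖odd-squares {as = as} {n} {m} m≡ .from-into ys (sol , odd-ys) =
    ℤ.*-cancelˡ-≡ (+ 8) _ _ (∙-cancelˡ (+ sum as) _ _ (begin
      + sum as + + 8 * wsum triangular as (Vec.map fromOdd ys)   ≡⟨ wsum-square-toOdd as (Vec.map fromOdd ys) ⟨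
      wsum square as (Vec.map toOdd (Vec.map fromOdd ys))      ≡⟨ cong (wsum square as) (map-toOdd∘fromOdd odd-ys) ⟩
      wsum square as ys                                        ≡⟨ sol ⟩
      + m                                                      ≡⟨ pos-8*+ n (sum as) m≡ ⟩
      + sum as + + 8 * + n                                     ∎))
    where open ≡-Reasoning
  triangular⤖odd-squares _ .from∘to xs _            = map-fromOdd∘toOdd xs
  triangular⤖odd-squares _ .to∘from ys (_ , odd-ys) = map-toOdd∘fromOdd odd-ys

open Squares using (fromOdd; odd-square; even-square; triangular⤖odd-squares)

t≡count-odd-squares : ∀ {k} {as : Vec ℕ k} → VecAll NonZero as → ∀ n {m} → m ≡ 8 ℕ.* n ℕ.+ sum as →
  t as n ≡ count (SquareSol? as m ∩? VecAll.all? odd?) (suc m)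
t≡count-odd-squares {as = as} as≢0 n {m} m≡ =
  count-≡-by-bijection (TriangularSol? as n) (SquareSol? as m ∩? VecAll.all? odd?) (TriangularSol-bounded as≢0)
    (λ sol-odd → SquareSol-bounded as≢0 (proj₁ sol-odd)) (triangular⤖odd-squares {as = as} m≡)

module QuadraticForm where
  open import Data.Integer using (_+_; _-_; _*_; -_)

  form₃ : ℤ → ℤ → ℤ → ℤ → ℤ → ℤ
  form₃ A B q₁ q₂ q₃ = A * q₁ + + 3 * A * q₂ + + 2 * B * q₃

  form₃-cong : ∀ A B {q₁ q₂ q₃ r₁ r₂ r₃} → q₁ ≡ r₁ → q₂ ≡ r₂ → q₃ ≡ r₃ →
    form₃ A B q₁ q₂ q₃ ≡ form₃ A B r₁ r₂ r₃
  form₃-cong A B refl refl refl = refl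

  form₃-x²+3y² : ∀ A B {p₁ p₂ q₁ q₂} r → p₁ + + 3 * p₂ ≡ q₁ + + 3 * q₂ → form₃ A B p₁ p₂ r ≡ form₃ A B q₁ q₂ r
  form₃-x²+3y² A B {p₁} {p₂} {q₁} {q₂} r e =
    trans (factor A B p₁ p₂ r) (trans (cong (λ z → A * z + + 2 * B * r) e) (sym (factor A B q₁ q₂ r)))
    where
    factor : ∀ A B p q r → A * p + + 3 * A * q + + 2 * B * r ≡ A * (p + + 3 * q) + + 2 * B * r
    factor = solve-∀

  excess-≢ : ∀ {L R w} c Y .{{_ : ℤ.NonZero c}} → Odd w → L ≡ R + c * (w + + 2 * Y) → L ≢ R
  excess-≢ {L} {R} {w} c Y odd-w L≡R+excess L≡R = ≡2*⇒¬odd (- Y) w≡2*[-Y] odd-w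
    where
    open ≡-Reasoning
    excess≡0 : w + + 2 * Y ≡ + 0
    excess≡0 = ℤ.*-cancelˡ-≡ c _ _ (∙-cancelˡ R _ _ (begin
      R + c * (w + + 2 * Y)   ≡⟨ L≡R+excess ⟨
      L                       ≡⟨ L≡R ⟩
      R                       ≡⟨ ℤ.+-identityʳ R ⟨
      R + + 0                 ≡⟨ cong (λ z → R + z) (ℤ.*-zeroʳ c) ⟨
      R + c * + 0             ∎))
    regroup : ∀ w Y → w ≡ w + + 2 * Y + + 2 * (- Y)
    regroup = solve-∀
    w≡2*[-Y] : w ≡ + 2 * (- Y)
    w≡2*[-Y] = begin
      w                           ≡⟨ regroup w Y ⟩
      w + + 2 * Y + + 2 * (- Y)   ≡⟨ cong (_+ + 2 * (- Y)) excess≡0 ⟩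
      + 0 + + 2 * (- Y)           ≡⟨ ℤ.+-identityˡ _ ⟩
      + 2 * (- Y)                 ∎

  -- Substituting the parities of y₁, y₂, y₃ shows that form₃ exceeds the target by 1, 2 or 4
  -- times an odd number; this is the equation read modulo 2, 4 or 8.
  private
    excess-odd-even : ∀ A B N t₁ r q₃ →
      A * (+ 1 + + 8 * t₁) + + 3 * A * (+ 4 * (r * r)) + + 2 * B * q₃
        ≡ + 8 * N + + 4 * A + + 2 * B
          + + 1 * (A + + 2 * (+ 4 * A * t₁ + + 6 * A * (r * r) + B * (q₃ - + 1) - + 4 * N - + 2 * A))
    excess-odd-even = solve-∀

    excess-odd-odd-even : ∀ A B N t₁ t₂ s →
      A * (+ 1 + + 8 * t₁) + + 3 * A * (+ 1 + + 8 * t₂) + + 2 * B * (+ 4 * (s * s))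
        ≡ + 8 * N + + 4 * A + + 2 * B
          + + 2 * (B + + 2 * (+ 2 * A * t₁ + + 6 * A * t₂ + + 2 * B * (s * s) - + 2 * N - B))
    excess-odd-odd-even = solve-∀

    excess-even-odd : ∀ A B N u t₂ q₃ →
      A * (+ 4 * (u * u)) + + 3 * A * (+ 1 + + 8 * t₂) + + 2 * B * q₃
        ≡ + 8 * N + + 4 * A + + 2 * B
          + + 1 * (A + + 2 * (+ 2 * A * (u * u) + + 12 * A * t₂ + B * (q₃ - + 1) - + 4 * N - A))
    excess-even-odd = solve-∀

    excess-even-even-even : ∀ A B N u v s →
      A * (+ 4 * (u * u)) + + 3 * A * (+ 4 * (v * v)) + + 2 * B * (+ 4 * (s * s))
        ≡ + 8 * N + + 4 * A + + 2 * B
          + + 2 * (B + + 2 * (A * (u * u) + + 3 * A * (v * v) + + 2 * B * (s * s) - + 2 * N - A - B))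
    excess-even-even-even = solve-∀

    excess-even-even-odd : ∀ A B N w v t₃ →
      A * (+ 4 * ((+ 2 * w - v) * (+ 2 * w - v))) + + 3 * A * (+ 4 * (v * v)) + + 2 * B * (+ 1 + + 8 * t₃)
        ≡ + 8 * N + + 4 * A + + 2 * B
          + + 4 * (A + + 2 * (+ 2 * A * (w * w - w * v + v * v) + + 2 * B * t₃ - N - A))
    excess-even-even-odd = solve-∀

  odd-y₁⇒odd-y₂×odd-y₃ : ∀ {A B} N y₁ y₂ y₃ → Odd A → Odd B →
    form₃ A B (y₁ * y₁) (y₂ * y₂) (y₃ * y₃) ≡ + 8 * N + + 4 * A + + 2 * B → Odd y₁ → Odd y₂ × Odd y₃
  odd-y₁⇒odd-y₂×odd-y₃ {A} {B} N y₁ y₂ y₃ odd-A odd-B sol odd-y₁ with odd? y₂ | odd? y₃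
  ... | no ¬odd-y₂ | _ = contradiction sol (excess-≢ (+ 1) _ odd-A (trans
        (form₃-cong A B (odd-square odd-y₁) (even-square ¬odd-y₂) refl)
        (excess-odd-even A B N (triangular (fromOdd y₁)) (half y₂) (y₃ * y₃))))
  ... | yes odd-y₂ | no ¬odd-y₃ = contradiction sol (excess-≢ (+ 2) _ odd-B (trans
        (form₃-cong A B (odd-square odd-y₁) (odd-square odd-y₂) (even-square ¬odd-y₃))
        (excess-odd-odd-even A B N (triangular (fromOdd y₁)) (triangular (fromOdd y₂)) (half y₃))))
  ... | yes odd-y₂ | yes odd-y₃ = odd-y₂ , odd-y₃

  even-y₁⇒even-y₂×odd-half-sum : ∀ {A B} N y₁ y₂ y₃ → Odd A → Odd B →
    form₃ A B (y₁ * y₁) (y₂ * y₂) (y₃ * y₃) ≡ + 8 * N + + 4 * A + + 2 * B → ¬ Odd y₁ →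
    ¬ Odd y₂ × Odd (half y₁ + half y₂)
  even-y₁⇒even-y₂×odd-half-sum {A} {B} N y₁ y₂ y₃ odd-A odd-B sol ¬odd-y₁
    with odd? y₂ | odd? y₃ | odd? (half y₁ + half y₂)
  ... | yes odd-y₂ | _ | _ = contradiction sol (excess-≢ (+ 1) _ odd-A (trans
        (form₃-cong A B (even-square ¬odd-y₁) (odd-square odd-y₂) refl)
        (excess-even-odd A B N (half y₁) (triangular (fromOdd y₂)) (y₃ * y₃))))
  ... | no ¬odd-y₂ | no ¬odd-y₃ | _ = contradiction sol (excess-≢ (+ 2) _ odd-B (trans
        (form₃-cong A B (even-square ¬odd-y₁) (even-square ¬odd-y₂) (even-square ¬odd-y₃))
        (excess-even-even-even A B N (half y₁) (half y₂) (half y₃))))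
  ... | no ¬odd-y₂ | yes odd-y₃ | no ¬odd-sum = contradiction sol (excess-≢ (+ 4) _ odd-A (trans
        (form₃-cong A B y₁² (even-square ¬odd-y₂) (odd-square odd-y₃))
        (excess-even-even-odd A B N w v (triangular (fromOdd y₃)))))
    where
    u v w : ℤ
    u = half y₁
    v = half y₂
    w = half (u + v)
    subtract : ∀ u v → u ≡ u + v - v
    subtract = solve-∀
    u≡2w-v : u ≡ + 2 * w - v
    u≡2w-v = trans (subtract u v) (cong (_- v) (¬odd⇒≡2*half ¬odd-sum))
    y₁² : y₁ * y₁ ≡ + 4 * ((+ 2 * w - v) * (+ 2 * w - v))
    y₁² = trans (even-square ¬odd-y₁) (cong (λ z → + 4 * (z * z)) u≡2w-v)
  ... | no ¬odd-y₂ | yes _ | yes odd-sum = ¬odd-y₂ , odd-sum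

  half-diff : ∀ {y₁ y₂} h → y₁ ≡ y₂ + + 2 * h → half (y₁ - y₂) ≡ h
  half-diff {y₂ = y₂} h refl = ≡2*⇒half≡ h (cancel y₂ h)
    where
    cancel : ∀ y h → y + + 2 * h - y ≡ + 2 * h
    cancel = solve-∀

  half-sum : ∀ {y₁ y₂} h → y₁ ≡ y₂ + + 2 * h → half (y₁ - - y₂) ≡ h + y₂
  half-sum {y₂ = y₂} h refl = ≡2*⇒half≡ (h + y₂) (regroup y₂ h)
    where
    regroup : ∀ y h → y + + 2 * h - - y ≡ + 2 * (h + y)
    regroup = solve-∀

  HalfDiffOdd : Pred (Vec ℤ 4) 0ℓ
  HalfDiffOdd (y₁ ∷ y₂ ∷ _) = Odd (half (y₁ - y₂))

  HalfDiffOdd? : Decidable HalfDiffOdd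
  HalfDiffOdd? (y₁ ∷ y₂ ∷ _) = odd? (half (y₁ - y₂))

  negate₂ : Vec ℤ 4 → Vec ℤ 4
  negate₂ (y₁ ∷ y₂ ∷ y₃ ∷ y₄ ∷ []) = y₁ ∷ - y₂ ∷ y₃ ∷ y₄ ∷ []

  negate₂-involutive : ∀ v → negate₂ (negate₂ v) ≡ v
  negate₂-involutive (y₁ ∷ y₂ ∷ y₃ ∷ y₄ ∷ []) = cong (λ z → y₁ ∷ z ∷ y₃ ∷ y₄ ∷ []) (ℤ.neg-involutive y₂)

  -- (y₁, y₂) ↦ ((y₁ + 3y₂)/2, (y₁ − y₂)/2) is an involutive automorphism of x² + 3y² on pairs of equal parity.
  rotate : Vec ℤ 4 → Vec ℤ 4
  rotate (y₁ ∷ y₂ ∷ y₃ ∷ y₄ ∷ []) = half (y₁ + + 3 * y₂) ∷ half (y₁ - y₂) ∷ y₃ ∷ y₄ ∷ []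

  rotate-≡ : ∀ {y₁ y₂ y₃ y₄} h → y₁ ≡ y₂ + + 2 * h →
    rotate (y₁ ∷ y₂ ∷ y₃ ∷ y₄ ∷ []) ≡ h + + 2 * y₂ ∷ h ∷ y₃ ∷ y₄ ∷ []
  rotate-≡ {y₂ = y₂} {y₃} {y₄} h refl =
    cong₂ (λ p q → p ∷ q ∷ y₃ ∷ y₄ ∷ []) (≡2*⇒half≡ (h + + 2 * y₂) (regroup y₂ h)) (half-diff {y₂ = y₂} h refl)
    where
    regroup : ∀ y h → y + + 2 * h + + 3 * y ≡ + 2 * (h + + 2 * y)
    regroup = solve-∀

  rotate-involutive : ∀ {y₁ y₂ y₃ y₄} h → y₁ ≡ y₂ + + 2 * h →
    rotate (rotate (y₁ ∷ y₂ ∷ y₃ ∷ y₄ ∷ [])) ≡ y₁ ∷ y₂ ∷ y₃ ∷ y₄ ∷ []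
  rotate-involutive {y₂ = y₂} h refl = trans (cong rotate (rotate-≡ h refl)) (rotate-≡ y₂ refl)

  rotate-x²+3y² : ∀ {y₁ y₂} h → y₁ ≡ y₂ + + 2 * h →
    (h + + 2 * y₂) * (h + + 2 * y₂) + + 3 * (h * h) ≡ y₁ * y₁ + + 3 * (y₂ * y₂)
  rotate-x²+3y² {y₂ = y₂} h refl = expand y₂ h
    where
    expand : ∀ y h → (h + + 2 * y) * (h + + 2 * y) + + 3 * (h * h) ≡ (y + + 2 * h) * (y + + 2 * h) + + 3 * (y * y)
    expand = solve-∀

open QuadraticForm

module Representations (a b d n : ℕ) .{{_ : NonZero a}} .{{_ : NonZero b}} .{{_ : NonZero d}}
                       (odd-a : Odd (+ a)) (odd-b : Odd (+ b)) where
  open import Data.Integer using (_+_; _-_; _*_; -_)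

  coeffs : ℕ → Vec ℕ 4
  coeffs c = a ∷ 3 ℕ.* a ∷ 2 ℕ.* b ∷ c ∷ []

  m : ℕ
  m = 8 ℕ.* n ℕ.+ 4 ℕ.* a ℕ.+ 2 ℕ.* b ℕ.+ d

  Sol : ℕ → Pred (Vec ℤ 4) 0ℓ
  Sol c = SquareSol (coeffs c) m

  Sol? : ∀ c → Decidable (Sol c)
  Sol? c = SquareSol? (coeffs c) m

  coeffs≢0 : ∀ {c} → NonZero c → VecAll NonZero (coeffs c)
  coeffs≢0 c≢0 = ℕ.>-nonZero (ℕ.>-nonZero⁻¹ a) ∷ ℕ.m*n≢0 3 a ∷ ℕ.m*n≢0 2 b ∷ c≢0 ∷ []

  d≢0 : NonZero d
  d≢0 = ℕ.>-nonZero (ℕ.>-nonZero⁻¹ d)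

  Sol-bounded : ∀ {c} → NonZero c → Sol c ⊆ InBox (suc m)
  Sol-bounded c≢0 = SquareSol-bounded (coeffs≢0 c≢0)

  m≡8n+sum : m ≡ 8 ℕ.* n ℕ.+ sum (coeffs d)
  m≡8n+sum = identity a b d n
    where
    identity : ∀ a b d n → 8 ℕ.* n ℕ.+ 4 ℕ.* a ℕ.+ 2 ℕ.* b ℕ.+ d ≡ 8 ℕ.* n ℕ.+ (a ℕ.+ (3 ℕ.* a ℕ.+ (2 ℕ.* b ℕ.+ (d ℕ.+ 0))))
    identity = ℕ-Solver.solve-∀

  +m≡ : + m ≡ + 8 * + n + + 4 * + a + + 2 * + b + + d
  +m≡ = begin
    + (8 ℕ.* n ℕ.+ 4 ℕ.* a ℕ.+ 2 ℕ.* b ℕ.+ d)           ≡⟨ ℤ.pos-+ (8 ℕ.* n ℕ.+ 4 ℕ.* a ℕ.+ 2 ℕ.* b) d ⟩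
    + (8 ℕ.* n ℕ.+ 4 ℕ.* a ℕ.+ 2 ℕ.* b) + + d          ≡⟨ cong (_+ + d) (ℤ.pos-+ (8 ℕ.* n ℕ.+ 4 ℕ.* a) (2 ℕ.* b)) ⟩
    + (8 ℕ.* n ℕ.+ 4 ℕ.* a) + + (2 ℕ.* b) + + d        ≡⟨ cong (λ z → z + + (2 ℕ.* b) + + d) (ℤ.pos-+ (8 ℕ.* n) (4 ℕ.* a)) ⟩
    + (8 ℕ.* n) + + (4 ℕ.* a) + + (2 ℕ.* b) + + d      ≡⟨ cong₂ (λ p q → p + q + + (2 ℕ.* b) + + d) (ℤ.pos-* 8 n) (ℤ.pos-* 4 a) ⟩
    + 8 * + n + + 4 * + a + + (2 ℕ.* b) + + d          ≡⟨ cong (λ z → + 8 * + n + + 4 * + a + z + + d) (ℤ.pos-* 2 b) ⟩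
    + 8 * + n + + 4 * + a + + 2 * + b + + d            ∎
    where open ≡-Reasoning

  wsum-coeffs : ∀ c y₁ y₂ y₃ y₄ →
    wsum square (coeffs c) (y₁ ∷ y₂ ∷ y₃ ∷ y₄ ∷ []) ≡ form₃ (+ a) (+ b) (y₁ * y₁) (y₂ * y₂) (y₃ * y₃) + + c * (y₄ * y₄)
  wsum-coeffs c y₁ y₂ y₃ y₄ =
    trans (cong₂ (λ p q → + a * (y₁ * y₁) + (p * (y₂ * y₂) + (q * (y₃ * y₃) + (+ c * (y₄ * y₄) + + 0))))
                 (ℤ.pos-* 3 a) (ℤ.pos-* 2 b))
          (reassoc (+ a) (+ b) (+ c) (y₁ * y₁) (y₂ * y₂) (y₃ * y₃) (y₄ * y₄))
    where
    reassoc : ∀ A B C p q r s →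
      A * p + (+ 3 * A * q + (+ 2 * B * r + (C * s + + 0))) ≡ A * p + + 3 * A * q + + 2 * B * r + C * s
    reassoc = solve-∀

  Sol-x²+3y² : ∀ c y₁ y₂ z₁ z₂ y₃ y₄ → z₁ * z₁ + + 3 * (z₂ * z₂) ≡ y₁ * y₁ + + 3 * (y₂ * y₂) →
    Sol c (y₁ ∷ y₂ ∷ y₃ ∷ y₄ ∷ []) → Sol c (z₁ ∷ z₂ ∷ y₃ ∷ y₄ ∷ [])
  Sol-x²+3y² c y₁ y₂ z₁ z₂ y₃ y₄ e sol = begin
    wsum square (coeffs c) (z₁ ∷ z₂ ∷ y₃ ∷ y₄ ∷ [])                      ≡⟨ wsum-coeffs c z₁ z₂ y₃ y₄ ⟩
    form₃ (+ a) (+ b) (z₁ * z₁) (z₂ * z₂) (y₃ * y₃) + + c * (y₄ * y₄)    ≡⟨ cong (_+ + c * (y₄ * y₄)) (form₃-x²+3y² (+ a) (+ b) (y₃ * y₃) e) ⟩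
    form₃ (+ a) (+ b) (y₁ * y₁) (y₂ * y₂) (y₃ * y₃) + + c * (y₄ * y₄)    ≡⟨ wsum-coeffs c y₁ y₂ y₃ y₄ ⟨
    wsum square (coeffs c) (y₁ ∷ y₂ ∷ y₃ ∷ y₄ ∷ [])                      ≡⟨ sol ⟩
    + m                                                                  ∎
    where open ≡-Reasoning

  -- An odd y₄ contributes d y₄² = d + 8 d T, which is absorbed into the 8 n part of the target.
  Sol⇒form₃≡ : ∀ y₁ y₂ y₃ y₄ → Sol d (y₁ ∷ y₂ ∷ y₃ ∷ y₄ ∷ []) → Odd y₄ →
    form₃ (+ a) (+ b) (y₁ * y₁) (y₂ * y₂) (y₃ * y₃)
      ≡ + 8 * (+ n - + d * triangular (fromOdd y₄)) + + 4 * + a + + 2 * + b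
  Sol⇒form₃≡ y₁ y₂ y₃ y₄ sol odd-y₄ = ∙-cancelʳ (+ d * (+ 1 + + 8 * T)) _ _ (begin
    F + + d * (+ 1 + + 8 * T)                                   ≡⟨ cong (λ q → F + + d * q) (odd-square odd-y₄) ⟨
    F + + d * (y₄ * y₄)                                         ≡⟨ wsum-coeffs d y₁ y₂ y₃ y₄ ⟨
    wsum square (coeffs d) (y₁ ∷ y₂ ∷ y₃ ∷ y₄ ∷ [])             ≡⟨ sol ⟩
    + m                                                         ≡⟨ +m≡ ⟩
    + 8 * + n + + 4 * + a + + 2 * + b + + d                     ≡⟨ regroup (+ n) (+ a) (+ b) (+ d) T ⟩
    + 8 * (+ n - + d * T) + + 4 * + a + + 2 * + b + + d * (+ 1 + + 8 * T) ∎)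
    where
    open ≡-Reasoning
    T F : ℤ
    T = triangular (fromOdd y₄)
    F = form₃ (+ a) (+ b) (y₁ * y₁) (y₂ * y₂) (y₃ * y₃)
    regroup : ∀ N A B D T → + 8 * N + + 4 * A + + 2 * B + D ≡ + 8 * (N - D * T) + + 4 * A + + 2 * B + D * (+ 1 + + 8 * T)
    regroup = solve-∀

  SolOdd₄ SolOddOdd SolEvenOdd : Pred (Vec ℤ 4) 0ℓ
  SolOdd₄    = Sol d ∩ Odd ∘ last
  SolOddOdd  = SolOdd₄ ∩ Odd ∘ head
  SolEvenOdd = SolOdd₄ ∩ ∁ (Odd ∘ head)

  SolOdd₄? : Decidable SolOdd₄
  SolOdd₄? = Sol? d ∩? odd? ∘ last

  SolOddOdd? : Decidable SolOddOdd
  SolOddOdd? = SolOdd₄? ∩? odd? ∘ head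

  SolEvenOdd? : Decidable SolEvenOdd
  SolEvenOdd? = SolOdd₄? ∩? ∁? (odd? ∘ head)

  SolOddOdd⇒odd-y₂×odd-y₃ : ∀ y₁ y₂ y₃ y₄ → SolOddOdd (y₁ ∷ y₂ ∷ y₃ ∷ y₄ ∷ []) → Odd y₂ × Odd y₃
  SolOddOdd⇒odd-y₂×odd-y₃ y₁ y₂ y₃ y₄ ((sol , odd-y₄) , odd-y₁) =
    odd-y₁⇒odd-y₂×odd-y₃ (+ n - + d * triangular (fromOdd y₄)) y₁ y₂ y₃ odd-a odd-b (Sol⇒form₃≡ y₁ y₂ y₃ y₄ sol odd-y₄) odd-y₁

  SolOddOdd⇒≡+2* : ∀ y₁ y₂ y₃ y₄ → SolOddOdd (y₁ ∷ y₂ ∷ y₃ ∷ y₄ ∷ []) → y₁ ≡ y₂ + + 2 * (half y₁ - half y₂)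
  SolOddOdd⇒≡+2* y₁ y₂ y₃ y₄ s = odd-odd⇒≡+2* (proj₂ s) (proj₁ (SolOddOdd⇒odd-y₂×odd-y₃ y₁ y₂ y₃ y₄ s))

  SolEvenOdd⇒even-y₂×odd-half-sum : ∀ y₁ y₂ y₃ y₄ → SolEvenOdd (y₁ ∷ y₂ ∷ y₃ ∷ y₄ ∷ []) →
    ¬ Odd y₂ × Odd (half y₁ + half y₂)
  SolEvenOdd⇒even-y₂×odd-half-sum y₁ y₂ y₃ y₄ ((sol , odd-y₄) , ¬odd-y₁) =
    even-y₁⇒even-y₂×odd-half-sum (+ n - + d * triangular (fromOdd y₄)) y₁ y₂ y₃ odd-a odd-b (Sol⇒form₃≡ y₁ y₂ y₃ y₄ sol odd-y₄) ¬odd-y₁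

  SolEvenOdd⇒≡+2* : ∀ y₁ y₂ y₃ y₄ → SolEvenOdd (y₁ ∷ y₂ ∷ y₃ ∷ y₄ ∷ []) → y₁ ≡ y₂ + + 2 * (half y₁ - half y₂)
  SolEvenOdd⇒≡+2* y₁ y₂ y₃ y₄ s =
    even-even⇒≡+2* (proj₂ s) (proj₁ (SolEvenOdd⇒even-y₂×odd-half-sum y₁ y₂ y₃ y₄ s))

  negate₂-SolOddOdd : ∀ y₁ y₂ y₃ y₄ → SolOddOdd (y₁ ∷ y₂ ∷ y₃ ∷ y₄ ∷ []) → SolOddOdd (y₁ ∷ - y₂ ∷ y₃ ∷ y₄ ∷ [])
  negate₂-SolOddOdd y₁ y₂ y₃ y₄ ((sol , odd-y₄) , odd-y₁) = (Sol-x²+3y² d y₁ y₂ y₁ (- y₂) y₃ y₄ (square-neg y₁ y₂) sol , odd-y₄) , odd-y₁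
    where
    square-neg : ∀ y₁ y₂ → y₁ * y₁ + + 3 * (- y₂ * - y₂) ≡ y₁ * y₁ + + 3 * (y₂ * y₂)
    square-neg = solve-∀

  wsum-double-last : ∀ y₁ y₂ y₃ w →
    wsum square (coeffs d) (y₁ ∷ y₂ ∷ y₃ ∷ + 2 * w ∷ []) ≡ wsum square (coeffs (4 ℕ.* d)) (y₁ ∷ y₂ ∷ y₃ ∷ w ∷ [])
  wsum-double-last y₁ y₂ y₃ w = begin
    wsum square (coeffs d) (y₁ ∷ y₂ ∷ y₃ ∷ + 2 * w ∷ [])  ≡⟨ wsum-coeffs d y₁ y₂ y₃ (+ 2 * w) ⟩
    F + + d * (+ 2 * w * (+ 2 * w))                       ≡⟨ cong (λ z → F + z) (regroup (+ d) w) ⟩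
    F + + 4 * + d * (w * w)                               ≡⟨ cong (λ c → F + c * (w * w)) (ℤ.pos-* 4 d) ⟨
    F + + (4 ℕ.* d) * (w * w)                             ≡⟨ wsum-coeffs (4 ℕ.* d) y₁ y₂ y₃ w ⟨
    wsum square (coeffs (4 ℕ.* d)) (y₁ ∷ y₂ ∷ y₃ ∷ w ∷ []) ∎
    where
    open ≡-Reasoning
    F : ℤ
    F = form₃ (+ a) (+ b) (y₁ * y₁) (y₂ * y₂) (y₃ * y₃)
    regroup : ∀ D w → D * (+ 2 * w * (+ 2 * w)) ≡ + 4 * D * (w * w)
    regroup = solve-∀

  halve-last : SubsetBijection (Sol d ∩ ∁ (Odd ∘ last)) (Sol (4 ℕ.* d))
  halve-last .to   (y₁ ∷ y₂ ∷ y₃ ∷ y₄ ∷ []) = y₁ ∷ y₂ ∷ y₃ ∷ half y₄ ∷ []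
  halve-last .from (y₁ ∷ y₂ ∷ y₃ ∷ w ∷ [])  = y₁ ∷ y₂ ∷ y₃ ∷ + 2 * w ∷ []
  halve-last .to-into (y₁ ∷ y₂ ∷ y₃ ∷ y₄ ∷ []) (sol , ¬odd-y₄) =
    trans (sym (wsum-double-last y₁ y₂ y₃ (half y₄)))
          (subst (λ y → Sol d (y₁ ∷ y₂ ∷ y₃ ∷ y ∷ [])) (¬odd⇒≡2*half ¬odd-y₄) sol)
  halve-last .from-into (y₁ ∷ y₂ ∷ y₃ ∷ w ∷ []) sol = trans (wsum-double-last y₁ y₂ y₃ w) sol , ≡2*⇒¬odd w refl
  halve-last .from∘to (y₁ ∷ y₂ ∷ y₃ ∷ y₄ ∷ []) (_ , ¬odd-y₄) =
    cong (λ y → y₁ ∷ y₂ ∷ y₃ ∷ y ∷ []) (sym (¬odd⇒≡2*half ¬odd-y₄))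
  halve-last .to∘from (y₁ ∷ y₂ ∷ y₃ ∷ w ∷ []) _ = cong (λ y → y₁ ∷ y₂ ∷ y₃ ∷ y ∷ []) (≡2*⇒half≡ w refl)

  negate-y₂ : SubsetBijection (SolOddOdd ∩ HalfDiffOdd) (SolOddOdd ∩ ∁ HalfDiffOdd)
  negate-y₂ .to   = negate₂
  negate-y₂ .from = negate₂
  negate-y₂ .to-into (y₁ ∷ y₂ ∷ y₃ ∷ y₄ ∷ []) (s , hdo) =
    negate₂-SolOddOdd y₁ y₂ y₃ y₄ s ,
    subst (¬_ ∘ Odd) (sym (half-sum h e)) (odd-+-odd (subst Odd (half-diff h e) hdo) odd-y₂)
    where
    h = half y₁ - half y₂
    e = SolOddOdd⇒≡+2* y₁ y₂ y₃ y₄ s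
    odd-y₂ = proj₁ (SolOddOdd⇒odd-y₂×odd-y₃ y₁ y₂ y₃ y₄ s)
  negate-y₂ .from-into (y₁ ∷ y₂ ∷ y₃ ∷ y₄ ∷ []) (s , ¬hdo) =
    negate₂-SolOddOdd y₁ y₂ y₃ y₄ s ,
    subst Odd (sym (half-sum h e)) (¬odd-+-odd (¬hdo ∘ subst Odd (sym (half-diff h e))) odd-y₂)
    where
    h = half y₁ - half y₂
    e = SolOddOdd⇒≡+2* y₁ y₂ y₃ y₄ s
    odd-y₂ = proj₁ (SolOddOdd⇒odd-y₂×odd-y₃ y₁ y₂ y₃ y₄ s)
  negate-y₂ .from∘to v _ = negate₂-involutive v
  negate-y₂ .to∘from v _ = negate₂-involutive v

  rotation : SubsetBijection (SolOddOdd ∩ ∁ HalfDiffOdd) SolEvenOdd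
  rotation .to   = rotate
  rotation .from = rotate
  rotation .to-into (y₁ ∷ y₂ ∷ y₃ ∷ y₄ ∷ []) (s@((sol , odd-y₄) , _) , ¬hdo) =
    subst SolEvenOdd (sym (rotate-≡ {y₃ = y₃} {y₄ = y₄} h e))
      ((Sol-x²+3y² d y₁ y₂ (h + + 2 * y₂) h y₃ y₄ (rotate-x²+3y² h e) sol , odd-y₄) , ¬odd-+2* y₂ (¬hdo ∘ subst Odd (sym (half-diff h e))))
    where
    h = half y₁ - half y₂
    e = SolOddOdd⇒≡+2* y₁ y₂ y₃ y₄ s
  rotation .from-into (y₁ ∷ y₂ ∷ y₃ ∷ y₄ ∷ []) s@((sol , odd-y₄) , _) =
    subst (SolOddOdd ∩ ∁ HalfDiffOdd) (sym (rotate-≡ {y₃ = y₃} {y₄ = y₄} h e))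
      (((Sol-x²+3y² d y₁ y₂ (h + + 2 * y₂) h y₃ y₄ (rotate-x²+3y² h e) sol , odd-y₄) , odd-+2* y₂ odd-h) ,
       ¬odd-y₂ ∘ subst Odd (half-diff {y₂ = h} y₂ refl))
    where
    h = half y₁ - half y₂
    e = SolEvenOdd⇒≡+2* y₁ y₂ y₃ y₄ s
    ¬odd-y₂ = proj₁ (SolEvenOdd⇒even-y₂×odd-half-sum y₁ y₂ y₃ y₄ s)
    regroup : ∀ u v → u + v + + 2 * (- v) ≡ u - v
    regroup = solve-∀
    odd-h : Odd h
    odd-h = subst Odd (regroup (half y₁) (half y₂))
      (odd-+2* (- half y₂) (proj₂ (SolEvenOdd⇒even-y₂×odd-half-sum y₁ y₂ y₃ y₄ s)))
  rotation .from∘to (y₁ ∷ y₂ ∷ y₃ ∷ y₄ ∷ []) (s , _) = rotate-involutive _ (SolOddOdd⇒≡+2* y₁ y₂ y₃ y₄ s)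
  rotation .to∘from (y₁ ∷ y₂ ∷ y₃ ∷ y₄ ∷ []) s       = rotate-involutive _ (SolEvenOdd⇒≡+2* y₁ y₂ y₃ y₄ s)

  all-odd≐SolOddOdd : Sol d ∩ VecAll Odd ≐ SolOddOdd
  all-odd≐SolOddOdd = forget , extend
    where
    forget : Sol d ∩ VecAll Odd ⊆ SolOddOdd
    forget {_ ∷ _ ∷ _ ∷ _ ∷ []} (sol , odd-y₁ ∷ _ ∷ _ ∷ odd-y₄ ∷ []) = (sol , odd-y₄) , odd-y₁
    extend : SolOddOdd ⊆ Sol d ∩ VecAll Odd
    extend {y₁ ∷ y₂ ∷ y₃ ∷ y₄ ∷ []} s@((sol , odd-y₄) , odd-y₁) =
      let odd-y₂ , odd-y₃ = SolOddOdd⇒odd-y₂×odd-y₃ y₁ y₂ y₃ y₄ s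
      in  sol , odd-y₁ ∷ odd-y₂ ∷ odd-y₃ ∷ odd-y₄ ∷ []

  private
    E : ℕ
    E = count SolEvenOdd? (suc m)

    SolOddOdd∩-bounded : ∀ (R : Pred (Vec ℤ 4) 0ℓ) → SolOddOdd ∩ R ⊆ InBox (suc m)
    SolOddOdd∩-bounded _ s = Sol-bounded d≢0 (proj₁ (proj₁ (proj₁ s)))

  count-SolOddOdd : count SolOddOdd? (suc m) ≡ E ℕ.+ E
  count-SolOddOdd = begin
    count SolOddOdd? (suc m)
      ≡⟨ count-split SolOddOdd? HalfDiffOdd? (suc m) ⟩
    count (SolOddOdd? ∩? HalfDiffOdd?) (suc m) ℕ.+ count (SolOddOdd? ∩? ∁? HalfDiffOdd?) (suc m)
      ≡⟨ cong (ℕ._+ count (SolOddOdd? ∩? ∁? HalfDiffOdd?) (suc m))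
              (count-≡-by-bijection (SolOddOdd? ∩? HalfDiffOdd?) (SolOddOdd? ∩? ∁? HalfDiffOdd?)
                 (SolOddOdd∩-bounded HalfDiffOdd) (SolOddOdd∩-bounded (∁ HalfDiffOdd)) negate-y₂) ⟩
    count (SolOddOdd? ∩? ∁? HalfDiffOdd?) (suc m) ℕ.+ count (SolOddOdd? ∩? ∁? HalfDiffOdd?) (suc m)
      ≡⟨ cong₂ ℕ._+_ count-rotation count-rotation ⟩
    E ℕ.+ E
      ∎
    where
    open ≡-Reasoning
    count-rotation : count (SolOddOdd? ∩? ∁? HalfDiffOdd?) (suc m) ≡ E
    count-rotation = count-≡-by-bijection (SolOddOdd? ∩? ∁? HalfDiffOdd?) SolEvenOdd?
      (SolOddOdd∩-bounded (∁ HalfDiffOdd)) (λ s → Sol-bounded d≢0 (proj₁ (proj₁ s))) rotation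

  t≡E+E : t (coeffs d) n ≡ E ℕ.+ E
  t≡E+E = begin
    t (coeffs d) n                               ≡⟨ t≡count-odd-squares (coeffs≢0 d≢0) n m≡8n+sum ⟩
    count (Sol? d ∩? VecAll.all? odd?) (suc m)   ≡⟨ count-≐ (Sol? d ∩? VecAll.all? odd?) SolOddOdd? (suc m) all-odd≐SolOddOdd ⟩
    count SolOddOdd? (suc m)                     ≡⟨ count-SolOddOdd ⟩
    E ℕ.+ E                                      ∎
    where open ≡-Reasoning

  N≡E+E+E+N₄ : N (coeffs d) m ≡ E ℕ.+ E ℕ.+ E ℕ.+ N (coeffs (4 ℕ.* d)) m
  N≡E+E+E+N₄ = begin
    N (coeffs d) m
      ≡⟨ count-split (Sol? d) (odd? ∘ last) (suc m) ⟩
    count SolOdd₄? (suc m) ℕ.+ count (Sol? d ∩? ∁? (odd? ∘ last)) (suc m)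
      ≡⟨ cong₂ ℕ._+_ (count-split SolOdd₄? (odd? ∘ head) (suc m)) count-halve-last ⟩
    count SolOddOdd? (suc m) ℕ.+ E ℕ.+ N (coeffs (4 ℕ.* d)) m
      ≡⟨ cong (λ k → k ℕ.+ E ℕ.+ N (coeffs (4 ℕ.* d)) m) count-SolOddOdd ⟩
    E ℕ.+ E ℕ.+ E ℕ.+ N (coeffs (4 ℕ.* d)) m
      ∎
    where
    open ≡-Reasoning
    count-halve-last : count (Sol? d ∩? ∁? (odd? ∘ last)) (suc m) ≡ N (coeffs (4 ℕ.* d)) m
    count-halve-last = count-≡-by-bijection (Sol? d ∩? ∁? (odd? ∘ last)) (Sol? (4 ℕ.* d))
      (λ s → Sol-bounded d≢0 (proj₁ s)) (Sol-bounded (ℕ.m*n≢0 4 d)) halve-last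

  3t≡2[N-N₄] : + 3 * + t (coeffs d) n ≡ + 2 * (+ N (coeffs d) m - + N (coeffs (4 ℕ.* d)) m)
  3t≡2[N-N₄] = begin
    + 3 * + t (coeffs d) n                    ≡⟨ cong (λ k → + 3 * + k) t≡E+E ⟩
    + 3 * + (E ℕ.+ E)                         ≡⟨ arithmetic E N₄ ⟩
    + 2 * (+ (E ℕ.+ E ℕ.+ E ℕ.+ N₄) - + N₄)   ≡⟨ cong (λ k → + 2 * (+ k - + N₄)) N≡E+E+E+N₄ ⟨
    + 2 * (+ N (coeffs d) m - + N₄)           ∎
    where
    open ≡-Reasoning
    N₄ : ℕ
    N₄ = N (coeffs (4 ℕ.* d)) m
    identity : ∀ e k → + 3 * (e + e) ≡ + 2 * (e + e + e + k - k)
    identity = solve-∀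
    arithmetic : ∀ e k → + 3 * + (e ℕ.+ e) ≡ + 2 * (+ (e ℕ.+ e ℕ.+ e ℕ.+ k) - + k)
    arithmetic e k rewrite ℤ.pos-+ (e ℕ.+ e ℕ.+ e) k | ℤ.pos-+ (e ℕ.+ e) e | ℤ.pos-+ e e = identity (+ e) (+ k)

open import Data.Nat using (_+_; _*_)

theorem5p5 : (a b d n : ℕ) → .{{NonZero a}} → .{{NonZero b}} → .{{NonZero d}} → .{{NonZero n}} →
    ¬ (2 ∣ a * b) →
    + 3 ℤ.* + t (a ∷ 3 * a ∷ 2 * b ∷ d ∷ []) n
      ≡ + 2 ℤ.* (+ N (a ∷ 3 * a ∷ 2 * b ∷ d ∷ []) (8 * n + 4 * a + 2 * b + d)
                 ℤ.- + N (a ∷ 3 * a ∷ 2 * b ∷ 4 * d ∷ []) (8 * n + 4 * a + 2 * b + d))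
theorem5p5 a b d n 2∤ab =
  Representations.3t≡2[N-N₄] a b d n (¬2∣⇒odd (2∤ab ∘ ∣m⇒∣m*n b)) (¬2∣⇒odd (2∤ab ∘ ∣n⇒∣m*n a))
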